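{- $\mathrm{rc}_2(K_{2,4,16})=2$.
   Context: Given an edge coloring $c:E(G)\to[\ell]$, a path is rainbow if no two of its edges receive the same color. $(G,c)$ is rainbow $k$-connected if every pair of distinct vertices is joined by $k$ pairwise internally disjoint rainbow paths. The rainbow $k$-connection number $\mathrm{rc}_k(G)$ is the minimum $\ell$ such that some coloring $c:E(G)\to[\ell]$ makes $(G,c)$ rainbow $k$-connected. $K_{2,4,16}$ denotes the complete tripartite graph with parts of sizes $2,4,16$. -}

module Defs where

open import Data.Nat using (ℕ; _<_; _<?_)
open import Data.Fin using (Fin; toℕ; zero; suc; _≟_) renaming (_<_ to _<ᶠ_)
open import Data.Fin.Properties using (<-cmp)
open import Data.List using (List; []; _∷_)
open import Data.List.Relation.Unary.Unique.Propositional using (Unique)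
open import Data.List.Membership.Propositional using (_∈_; _∉_)
open import Data.Product using (Σ; ∃; _×_; _,_)
open import Data.Empty using (⊥-elim)
open import Relation.Nullary using (¬_; yes; no)
open import Relation.Binary.PropositionalEquality using (_≡_; _≢_; refl; sym; cong)
open import Relation.Binary.Definitions using (tri<; tri≈; tri>)

-- The complete tripartite graph K_{2,4,16} on vertex set Fin 22:
-- vertices 0,1 form part 0; vertices 2..5 form part 1; vertices 6..21 form part 2.
V : Set
V = Fin 22

part : V → Fin 3
part v with toℕ v <? 2
... | yes _ = zero
... | no _ with toℕ v <? 6
...   | yes _ = suc zero
...   | no _ = suc (suc zero)

Adj : V → V → Set
Adj u v = part u ≢ part v

Adj-sym : ∀ u v → Adj u v → Adj v u
Adj-sym u v a e = a (sym e)

-- edges of the (simple, undirected) graph: unordered pairs, stored with u < v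
record Edge : Set where
  constructor edge
  field
    lo hi : V
    lo<hi : lo <ᶠ hi
    adj   : Adj lo hi

Coloring : ℕ → Set
Coloring ℓ = Edge → Fin ℓ

edgeOf : (u v : V) → Adj u v → Edge
edgeOf u v a with <-cmp u v
... | tri< lt _ _ = edge u v lt a
... | tri≈ _ eq _ = ⊥-elim (a (cong part eq))
... | tri> _ _ gt = edge v u gt (Adj-sym u v a)

data Walk : V → V → Set where
  nil  : (x : V) → Walk x x
  cons : ∀ {x y z} → Adj x y → Walk y z → Walk x z

vertices : ∀ {x y} → Walk x y → List V
vertices (nil x) = x ∷ []
vertices (cons {x} _ w) = x ∷ vertices w

initV : ∀ {x y} → Walk x y → List V
initV (nil x) = []
initV (cons {x} _ w) = x ∷ initV w

internal : ∀ {x y} → Walk x y → List V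
internal (nil x) = []
internal (cons _ w) = initV w

colors : ∀ {ℓ x y} → Coloring ℓ → Walk x y → List (Fin ℓ)
colors c (nil x) = []
colors c (cons {x} {y} a w) = c (edgeOf x y a) ∷ colors c w

IsPath : ∀ {x y} → Walk x y → Set
IsPath w = Unique (vertices w)

IsRainbowPath : ∀ {ℓ x y} → Coloring ℓ → Walk x y → Set
IsRainbowPath c w = IsPath w × Unique (colors c w)

InternallyDisjoint : ∀ {x y} → Walk x y → Walk x y → Set
InternallyDisjoint w₁ w₂ = ∀ v → v ∈ internal w₁ → v ∉ internal w₂

RainbowKConnected : ∀ {ℓ} → ℕ → Coloring ℓ → Set
RainbowKConnected k c =
  ∀ (x y : V) → x ≢ y →
  Σ (Fin k → Walk x y) λ P →
    (∀ i → IsRainbowPath c (P i)) ×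
    (∀ i j → i ≢ j → vertices (P i) ≢ vertices (P j) × InternallyDisjoint (P i) (P j))

RainbowKConnectableWith : ℕ → ℕ → Set
RainbowKConnectableWith k ℓ = ∃ λ (c : Coloring ℓ) → RainbowKConnected k c

RcIs : ℕ → ℕ → Set
RcIs k m = RainbowKConnectableWith k m × (∀ ℓ → ℓ < m → ¬ RainbowKConnectableWith k ℓ)

-- With two colours a rainbow path has length at most two, so it suffices to give every
-- pair of vertices two internally disjoint rainbow paths of length ≤ 2.  Colour every
-- edge between the two small parts 0; a vertex of the large part then corresponds to a
-- 0/1-label on the six vertices of the small parts.  The 16 labels used restrict to 01 or
-- 10 on the part of size 2 and to a vector of odd weight on the part of size 4, so any two
-- of them differ in at least two places and each has a 1 towards both small parts; these
-- facts provide the required rainbow midpoints.  One colour does not suffice because the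
-- two vertices of the smallest part are not adjacent.
module Submission where

open import Defs
open import Data.Bool using (Bool; true; false; if_then_else_; _xor_)
open import Data.Empty using (⊥-elim)
open import Data.Fin using (Fin; zero; suc; toℕ; _≟_)
open import Data.Fin.Properties using (all?; ¬Fin0)
open import Data.List using (List; []; _∷_; mapMaybe; allFin)
open import Data.List.Relation.Unary.All using ([]; _∷_)
open import Data.List.Relation.Unary.AllPairs using ([]; _∷_)
open import Data.List.Relation.Unary.Any using (here)
open import Data.Maybe as Maybe using (Maybe; just; nothing; Is-just; to-witness)
import Data.Maybe.Relation.Unary.Any as MaybeAny
open import Data.Nat using (ℕ; _<_; _∸_; _/_; _%_; _≡ᵇ_; _<ᵇ_; _≤ᵇ_; s≤s)
  renaming (suc to 1+_)
open import Data.Product using (Σ; ∃; _×_; _,_)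
open import Data.Unit using (tt)
open import Relation.Nullary using (¬_; Dec; yes; no; ¬?)
open import Relation.Nullary.Decidable using (_→-dec_; toWitness)
open import Relation.Binary.PropositionalEquality using (_≡_; _≢_; refl; sym; cong)

Adj⇒≢ : ∀ {u v} → Adj u v → u ≢ v
Adj⇒≢ a u≡v = a (cong part u≡v)

adj? : (u v : V) → Dec (Adj u v)
adj? u v = ¬? (part u ≟ part v)

RainbowLinked : ∀ {ℓ} → ℕ → Coloring ℓ → V → V → Set
RainbowLinked k c x y =
  Σ (Fin k → Walk x y) λ P →
    (∀ i → IsRainbowPath c (P i)) ×
    (∀ i j → i ≢ j → vertices (P i) ≢ vertices (P j) × InternallyDisjoint (P i) (P j))

rainbowLinked₂ : ∀ {ℓ} {c : Coloring ℓ} {x y} {p q : Walk x y} →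
  IsRainbowPath c p → IsRainbowPath c q → vertices p ≢ vertices q →
  InternallyDisjoint p q → InternallyDisjoint q p → RainbowLinked 2 c x y
rainbowLinked₂ {p = p} {q} rp rq p≢q pq qp = P , R , D
  where
  P : Fin 2 → Walk _ _
  P zero       = p
  P (suc zero) = q
  R : ∀ i → IsRainbowPath _ (P i)
  R zero       = rp
  R (suc zero) = rq
  D : ∀ i j → i ≢ j → vertices (P i) ≢ vertices (P j) × InternallyDisjoint (P i) (P j)
  D zero       zero       i≢j = ⊥-elim (i≢j refl)
  D zero       (suc zero) _   = p≢q , pq
  D (suc zero) zero       _   = (λ e → p≢q (sym e)) , qp
  D (suc zero) (suc zero) i≢j = ⊥-elim (i≢j refl)

direct : ∀ {x y} → Adj x y → Walk x y
direct xy = cons xy (nil _)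

direct-rainbow : ∀ {ℓ} (c : Coloring ℓ) {x y} (xy : Adj x y) → IsRainbowPath c (direct {x} {y} xy)
direct-rainbow c xy = (Adj⇒≢ xy ∷ []) ∷ ([] ∷ []) , [] ∷ []

record RainbowMidpoint {ℓ} (c : Coloring ℓ) (x y w : V) : Set where
  field
    adjˡ    : Adj x w
    adjʳ    : Adj w y
    colours : c (edgeOf x w adjˡ) ≢ c (edgeOf w y adjʳ)

module _ {ℓ} {c : Coloring ℓ} {x y : V} where

  via : ∀ {w} → RainbowMidpoint c x y w → Walk x y
  via {w} m = cons {x} {w} (RainbowMidpoint.adjˡ m) (direct {w} {y} (RainbowMidpoint.adjʳ m))

  via-rainbow : ∀ {w} → x ≢ y → (m : RainbowMidpoint c x y w) → IsRainbowPath c (via m)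
  via-rainbow x≢y m =
    (Adj⇒≢ adjˡ ∷ x≢y ∷ []) ∷ (Adj⇒≢ adjʳ ∷ []) ∷ [] ∷ [] ,
    (colours ∷ []) ∷ [] ∷ []
    where open RainbowMidpoint m

  via-disjoint : ∀ {w₁ w₂} (m₁ : RainbowMidpoint c x y w₁) (m₂ : RainbowMidpoint c x y w₂) →
    w₁ ≢ w₂ → InternallyDisjoint (via m₁) (via m₂)
  via-disjoint _ _ w₁≢w₂ _ (here refl) (here refl) = w₁≢w₂ refl

  via-vertices-≢ : ∀ {w₁ w₂} (m₁ : RainbowMidpoint c x y w₁) (m₂ : RainbowMidpoint c x y w₂) →
    w₁ ≢ w₂ → vertices (via m₁) ≢ vertices (via m₂)
  via-vertices-≢ _ _ w₁≢w₂ refl = w₁≢w₂ refl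

data ShortLinkage {ℓ} (c : Coloring ℓ) (x y : V) : Set where
  via-edge      : ∀ {w} → Adj x y → RainbowMidpoint c x y w → ShortLinkage c x y
  via-midpoints : ∀ {w₁ w₂} → RainbowMidpoint c x y w₁ → RainbowMidpoint c x y w₂ →
                  w₁ ≢ w₂ → ShortLinkage c x y

shortLinkage⇒rainbowLinked : ∀ {ℓ} {c : Coloring ℓ} {x y} → x ≢ y →
  ShortLinkage c x y → RainbowLinked 2 c x y
shortLinkage⇒rainbowLinked {c = c} {x} {y} x≢y (via-edge xy m) =
  rainbowLinked₂ (direct-rainbow c {x} {y} xy) (via-rainbow x≢y m) (λ ()) (λ _ ()) (λ _ _ ())
shortLinkage⇒rainbowLinked x≢y (via-midpoints m₁ m₂ w₁≢w₂) =
  rainbowLinked₂ (via-rainbow x≢y m₁) (via-rainbow x≢y m₂) (via-vertices-≢ m₁ m₂ w₁≢w₂)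
    (via-disjoint m₁ m₂ w₁≢w₂) (via-disjoint m₂ m₁ (λ e → w₁≢w₂ (sym e)))

rainbowMidpoint? : ∀ {ℓ} (c : Coloring ℓ) (x y w : V) → Maybe (RainbowMidpoint c x y w)
rainbowMidpoint? c x y w with adj? x w | adj? w y
... | yes xw | yes wy with c (edgeOf x w xw) ≟ c (edgeOf w y wy)
...   | no  ≢ = just (record { adjˡ = xw ; adjʳ = wy ; colours = ≢ })
...   | yes _ = nothing
rainbowMidpoint? c x y w | _ | _ = nothing

rainbowMidpoints : ∀ {ℓ} (c : Coloring ℓ) (x y : V) → List (∃ (RainbowMidpoint c x y))
rainbowMidpoints c x y = mapMaybe (λ w → Maybe.map (w ,_) (rainbowMidpoint? c x y w)) (allFin 22)

findShortLinkage : ∀ {ℓ} (c : Coloring ℓ) (x y : V) → Maybe (ShortLinkage c x y)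
findShortLinkage c x y = fromMidpoints (adj? x y) (rainbowMidpoints c x y)
  where
  fromMidpoints : Dec (Adj x y) → List (∃ (RainbowMidpoint c x y)) → Maybe (ShortLinkage c x y)
  fromMidpoints (yes xy) ((_ , m) ∷ _) = just (via-edge xy m)
  fromMidpoints (no _) ((w₁ , m₁) ∷ (w₂ , m₂) ∷ _) with w₁ ≟ w₂
  ... | no w₁≢w₂ = just (via-midpoints m₁ m₂ w₁≢w₂)
  ... | yes _    = nothing
  fromMidpoints _ _ = nothing

-- Vertex 6 + 4q + j of the large part (q, j < 4) has label [q mod 2 = a] on vertex a < 2
-- and [i = j] xor [q ≥ 2] on vertex 2 + i.

label : ℕ → ℕ → Bool
label k u = if u <ᵇ 2 then u ≡ᵇ q % 2 else ((u ∸ 2 ≡ᵇ k % 4) xor (2 ≤ᵇ q))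
  where q = k / 4

bitColour : Bool → Fin 2
bitColour false = zero
bitColour true  = suc zero

-- Edge.lo lies in a smaller part than Edge.hi, so hi < 6 means an edge between the small parts.
colour : Coloring 2
colour e = bitColour (if hi <ᵇ 6 then false else label (hi ∸ 6) lo)
  where
  lo = toℕ (Edge.lo e)
  hi = toℕ (Edge.hi e)

colour-shortLinked : ∀ x y → x ≢ y → Is-just (findShortLinkage colour x y)
colour-shortLinked = toWitness
  {a? = all? λ x → all? λ y → ¬? (x ≟ y) →-dec MaybeAny.dec (λ _ → yes tt) (findShortLinkage colour x y)}
  tt

colour-rainbow2Connected : RainbowKConnected 2 colour
colour-rainbow2Connected x y x≢y =
  shortLinkage⇒rainbowLinked x≢y (to-witness (colour-shortLinked x y x≢y))

no-colouring₀ : ¬ Coloring 0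
no-colouring₀ c = ¬Fin0 (c (edgeOf zero (suc (suc zero)) λ ()))

monochromatic-rainbow⇒Adj : (c : Coloring 1) {x y : V} (w : Walk x y) →
  IsRainbowPath c w → x ≢ y → Adj x y
monochromatic-rainbow⇒Adj c (nil _)                _                     x≢x = ⊥-elim (x≢x refl)
monochromatic-rainbow⇒Adj c (cons xy (nil _))      _                     _   = xy
monochromatic-rainbow⇒Adj c (cons _ (cons _ _))    (_ , (c₁≢c₂ ∷ _) ∷ _) _ = ⊥-elim (c₁≢c₂ (Fin1-≡ _ _))
  where
  Fin1-≡ : (i j : Fin 1) → i ≡ j
  Fin1-≡ zero zero = refl

¬rainbowConnectableWith-<2 : ∀ {k ℓ} → ℓ < 2 → ¬ RainbowKConnectableWith (1+ k) ℓ
¬rainbowConnectableWith-<2 {ℓ = 0}       _  (c , _)  = no-colouring₀ c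
¬rainbowConnectableWith-<2 {ℓ = 1}       _  (c , rc) with rc zero (suc zero) (λ ())
... | P , R , _ = monochromatic-rainbow⇒Adj c (P zero) (R zero) (λ ()) refl
¬rainbowConnectableWith-<2 {ℓ = 1+ 1+ _} (s≤s (s≤s ()))

theorem4p3 : RcIs 2 2
theorem4p3 = (colour , colour-rainbow2Connected) , λ _ ℓ<2 → ¬rainbowConnectableWith-<2 ℓ<2
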